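{- Let $k=k(n)$ satisfy $k\to\infty$ and $k\le n-1$, and let $Z_k=\sum_{j=0}^{k-1}L_j$, where $L_j$ is the number of chords of length $j$ in $C_n$. Then $Z_k/k\to 1$ in probability as $n\to\infty$.
   Context: A chord diagram of size $n$ is a perfect matching of the points $1,\dots,2n$ placed clockwise on a circle; $C_n$ is a uniformly random chord diagram of size $n$. The length of a chord $\langle x,y\rangle$ with $x<y$ is $\min(y-x-1,\,2n-y+x-1)$. -}

module Defs where

open import Data.Nat using (ℕ; zero; suc; _+_; _*_; _∸_; _<_; _≤_)
import Data.Nat as ℕ
open import Data.Nat.Properties using () renaming (_<?_ to _<ℕ?_)
open import Data.Integer using (+_)
open import Data.Rational using (ℚ; 0ℚ; 1ℚ; _/_; _-_; ∣_∣)
import Data.Rational as ℚ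
open import Data.Rational.Properties using () renaming (_<?_ to _<ℚ?_)
open import Data.List using (List; []; _∷_; map; concatMap; length; filter; upTo)
open import Data.Product using (_×_; _,_; proj₁; proj₂)

picks : {A : Set} → List A → List (A × List A)
picks [] = []
picks (x ∷ xs) = (x , xs) ∷ map (λ p → proj₁ p , x ∷ proj₂ p) (picks xs)

-- all perfect matchings of the points in the given list using exactly m chords;
-- a chord is recorded as (x , y) where x precedes y in the list.
-- Each perfect matching appears exactly once: the first point is paired with each
-- other point in turn, and the remaining points are matched recursively.
matchings : ℕ → List ℕ → List (List (ℕ × ℕ))
matchings zero [] = [] ∷ []
matchings zero (_ ∷ _) = []
matchings (suc m) [] = []
matchings (suc m) (x ∷ xs) =
  concatMap (λ p → map ((x , proj₁ p) ∷_) (matchings m (proj₂ p))) (picks xs)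

points : ℕ → List ℕ
points n = map suc (upTo (2 * n))

-- all chord diagrams of size n (the sample space of C_n, with uniform measure)
ChordDiagrams : ℕ → List (List (ℕ × ℕ))
ChordDiagrams n = matchings n (points n)

chordLength : ℕ → ℕ × ℕ → ℕ
chordLength n (x , y) = ℕ._⊓_ (y ∸ x ∸ 1) (2 * n + x ∸ y ∸ 1)

-- Z_k = Σ_{j<k} L_j = number of chords of length < k
Z : ℕ → ℕ → List (ℕ × ℕ) → ℕ
Z n k D = length (filter (λ c → chordLength n c <ℕ? k) D)

-- the fraction a / b as a rational (b = 0 gives 0 by convention; only used when b > 0)
frac : ℕ → ℕ → ℚ
frac a zero = 0ℚ
frac a (suc b) = (+ a) / suc b

-- P( |Z_k / k - 1| > ε ) for the uniform random chord diagram C_n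
probDeviation : ℕ → ℕ → ℚ → ℚ
probDeviation n k ε =
  frac (length (filter (λ D → ε <ℚ? ∣ frac (Z n k D) k - 1ℚ ∣) (ChordDiagrams n)))
       (length (ChordDiagrams n))

-- Second-moment method for Z, the number of short chords (length < k). A diagram with a marked
-- chord is a pair of points together with a diagram on the other 2n − 2 points, so summing Z and Z²
-- over all (2n − 1)!! diagrams reduces to sums over pairs of points: ∑ Z = (2n − 3)!! W and
-- ∑ Z² ≤ (2n − 3)!! W + (2n − 5)!! W², where W = 2nk is the number of short pairs (each point has 2k
-- short partners, as k ≤ n − 1). Hence ∑ (Z − k)² ≤ 5k (2n − 1)!!, and Chebyshev's inequality bounds
-- P(|Z/k − 1| > ε) by 5q²/k, where ε ≥ 1/q.
module Submission where

open import Data.Nat using (ℕ; zero; suc; _+_; _*_; _∸_; _≤_; _<_; _⊓_; z≤n; s≤s; s≤s⁻¹; >-nonZero)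
open import Data.Nat.Properties
open import Data.Nat.Tactic.RingSolver using (solve-∀)
open import Data.Integer as ℤ using (-[1+_]; _⊖_)
import Data.Integer.Properties as ℤ
open import Data.Rational as ℚ using (ℚ; mkℚ; 0ℚ; 1ℚ; _-_; ↧ₙ_; toℚᵘ)
import Data.Rational.Properties as ℚ
import Data.Rational.Unnormalised as ℚᵘ
import Data.Rational.Unnormalised.Properties as ℚᵘ
open import Data.Sum using (inj₁; inj₂)
open import Algebra.Properties.CommutativeSemigroup +-commutativeSemigroup
  using () renaming (interchange to +-interchange; x∙yz≈y∙xz to +-leftComm)
open import Algebra.Properties.CommutativeSemigroup *-commutativeSemigroup
  using () renaming (x∙yz≈y∙xz to *-leftComm)
open import Data.List using (List; []; _∷_; map; concatMap; length; filter; upTo; applyUpTo; _++_)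
open import Data.List.Properties using (length-map; length-upTo; map-applyUpTo)
open import Data.List.Relation.Unary.All as All using (All; []; _∷_; universal)
open import Data.List.Relation.Unary.All.Properties using (map⁺; ++⁺)
open import Data.List.Relation.Binary.Sublist.Propositional using (_⊆_; []; _∷_; _∷ʳ_; ⊆-refl)
open import Data.Product using (_×_; _,_; proj₁; proj₂; ∃-syntax)
open import Function using (_∘_)
open import Relation.Binary.PropositionalEquality
open import Relation.Nullary using (Dec; yes; no; ¬_)
open import Relation.Nullary.Negation using (contradiction)
open import Defs

open ≤-Reasoning

private variable
  A B : Set

∑ : (A → ℕ) → List A → ℕ
∑ f []       = 0
∑ f (x ∷ xs) = f x + ∑ f xs

∑-++ : (f : A → ℕ) (xs ys : List A) → ∑ f (xs ++ ys) ≡ ∑ f xs + ∑ f ys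
∑-++ f []       ys = refl
∑-++ f (x ∷ xs) ys = trans (cong (f x +_) (∑-++ f xs ys)) (sym (+-assoc (f x) _ _))

∑-map : (f : B → ℕ) (g : A → B) (xs : List A) → ∑ f (map g xs) ≡ ∑ (f ∘ g) xs
∑-map f g []       = refl
∑-map f g (x ∷ xs) = cong (f (g x) +_) (∑-map f g xs)

∑-concatMap : (f : B → ℕ) (g : A → List B) (xs : List A) →
  ∑ f (concatMap g xs) ≡ ∑ (λ a → ∑ f (g a)) xs
∑-concatMap f g []       = refl
∑-concatMap f g (x ∷ xs) =
  trans (∑-++ f (g x) (concatMap g xs)) (cong (∑ f (g x) +_) (∑-concatMap f g xs))

∑-congAll : {f g : A → ℕ} (xs : List A) → All (λ a → f a ≡ g a) xs → ∑ f xs ≡ ∑ g xs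
∑-congAll []       []       = refl
∑-congAll (x ∷ xs) (e ∷ es) = cong₂ _+_ e (∑-congAll xs es)

∑-cong : {f g : A → ℕ} → (∀ a → f a ≡ g a) → (xs : List A) → ∑ f xs ≡ ∑ g xs
∑-cong e xs = ∑-congAll xs (universal e xs)

∑-monoAll : {f g : A → ℕ} (xs : List A) → All (λ a → f a ≤ g a) xs → ∑ f xs ≤ ∑ g xs
∑-monoAll []       []       = z≤n
∑-monoAll (x ∷ xs) (e ∷ es) = +-mono-≤ e (∑-monoAll xs es)

∑-+ : (f g : A → ℕ) (xs : List A) → ∑ (λ a → f a + g a) xs ≡ ∑ f xs + ∑ g xs
∑-+ f g []       = refl
∑-+ f g (x ∷ xs) =
  trans (cong (f x + g x +_) (∑-+ f g xs)) (+-interchange (f x) (g x) (∑ f xs) (∑ g xs))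

∑-*ˡ : (c : ℕ) (f : A → ℕ) (xs : List A) → ∑ (λ a → c * f a) xs ≡ c * ∑ f xs
∑-*ˡ c f []       = sym (*-zeroʳ c)
∑-*ˡ c f (x ∷ xs) = trans (cong (c * f x +_) (∑-*ˡ c f xs)) (sym (*-distribˡ-+ c (f x) _))

∑-*ʳ : (c : ℕ) (f : A → ℕ) (xs : List A) → ∑ (λ a → f a * c) xs ≡ ∑ f xs * c
∑-*ʳ c f xs = trans (∑-cong (λ a → *-comm (f a) c) xs) (trans (∑-*ˡ c f xs) (*-comm c _))

∑-const : (c : ℕ) (xs : List A) → ∑ (λ _ → c) xs ≡ length xs * c
∑-const c []       = refl
∑-const c (x ∷ xs) = cong (c +_) (∑-const c xs)

∑-constAll : (c : ℕ) {f : A → ℕ} (xs : List A) → All (λ a → f a ≡ c) xs → ∑ f xs ≡ length xs * c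
∑-constAll c xs es = trans (∑-congAll xs es) (∑-const c xs)

∑-zero : {f : A → ℕ} → (∀ a → f a ≡ 0) → (xs : List A) → ∑ f xs ≡ 0
∑-zero e xs = trans (∑-cong e xs) (trans (∑-const 0 xs) (*-zeroʳ (length xs)))

∑-⊆ : (f : A → ℕ) {xs ys : List A} → xs ⊆ ys → ∑ f xs ≤ ∑ f ys
∑-⊆ f []                = z≤n
∑-⊆ f (_∷ʳ_ {ys = ys} y s) = ≤-trans (∑-⊆ f s) (m≤n+m (∑ f ys) (f y))
∑-⊆ f (refl ∷ s)         = +-monoʳ-≤ _ (∑-⊆ f s)

indicator : {P : Set} → Dec P → ℕ
indicator (yes _) = 1
indicator (no _)  = 0

indicator-yes : {P : Set} (d : Dec P) → P → indicator d ≡ 1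
indicator-yes (yes _) p = refl
indicator-yes (no ¬p) p = contradiction p ¬p

indicator-no : {P : Set} (d : Dec P) → ¬ P → indicator d ≡ 0
indicator-no (yes p) ¬p = contradiction p ¬p
indicator-no (no _)  _  = refl

indicator² : {P : Set} (d : Dec P) → indicator d * indicator d ≡ indicator d
indicator² (yes _) = refl
indicator² (no _)  = refl

indicator*≤ : {P : Set} (d : Dec P) (a b : ℕ) → (P → a ≤ b) → indicator d * a ≤ b
indicator*≤ (yes p) a b f = ≤-trans (≤-reflexive (+-identityʳ a)) (f p)
indicator*≤ (no _)  a b f = z≤n

length-filter≡∑indicator : {P : A → Set} (P? : (x : A) → Dec (P x)) (xs : List A) →
  length (filter P? xs) ≡ ∑ (λ x → indicator (P? x)) xs
length-filter≡∑indicator P? [] = refl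
length-filter≡∑indicator P? (x ∷ xs) with P? x
... | yes _ = cong suc (length-filter≡∑indicator P? xs)
... | no _  = length-filter≡∑indicator P? xs

length≡∑1 : (xs : List A) → length xs ≡ ∑ (λ _ → 1) xs
length≡∑1 xs = trans (sym (*-identityʳ (length xs))) (sym (∑-const 1 xs))

∑-picks-∷ : (f : A × List A → ℕ) (x : A) (xs : List A) →
  ∑ f (picks (x ∷ xs)) ≡ f (x , xs) + ∑ (λ p → f (proj₁ p , x ∷ proj₂ p)) (picks xs)
∑-picks-∷ f x xs = cong (f (x , xs) +_) (∑-map f _ (picks xs))

∑-picks-proj₁ : (f : A → ℕ) (xs : List A) → ∑ (f ∘ proj₁) (picks xs) ≡ ∑ f xs
∑-picks-proj₁ f []       = refl
∑-picks-proj₁ f (x ∷ xs) = trans (∑-picks-∷ (f ∘ proj₁) x xs) (cong (f x +_) (∑-picks-proj₁ f xs))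

length-picks : (xs : List A) → length (picks xs) ≡ length xs
length-picks []       = refl
length-picks (x ∷ xs) = cong suc (trans (length-map _ (picks xs)) (length-picks xs))

picks-length-rest : (xs : List A) → All (λ p → suc (length (proj₂ p)) ≡ length xs) (picks xs)
picks-length-rest []       = []
picks-length-rest (x ∷ xs) = refl ∷ map⁺ (All.map (cong suc) (picks-length-rest xs))

picks-⊆ : (xs : List A) → All (λ p → proj₂ p ⊆ xs) (picks xs)
picks-⊆ []       = []
picks-⊆ (x ∷ xs) = (x ∷ʳ ⊆-refl) ∷ map⁺ (All.map (refl ∷_) (picks-⊆ xs))

pairPicks : List A → List ((A × A) × List A)
pairPicks []       = []
pairPicks (x ∷ xs) =
  map (λ p → (x , proj₁ p) , proj₂ p) (picks xs) ++ map (λ q → proj₁ q , x ∷ proj₂ q) (pairPicks xs)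

∑-pairPicks-∷ : (f : (A × A) × List A → ℕ) (x : A) (xs : List A) →
  ∑ f (pairPicks (x ∷ xs)) ≡
  ∑ (λ p → f ((x , proj₁ p) , proj₂ p)) (picks xs) + ∑ (λ q → f (proj₁ q , x ∷ proj₂ q)) (pairPicks xs)
∑-pairPicks-∷ f x xs = trans (∑-++ f (map _ (picks xs)) _) (cong₂ _+_ (∑-map f _ (picks xs)) (∑-map f _ (pairPicks xs)))

pairPicks-length-rest : (xs : List A) → All (λ q → suc (suc (length (proj₂ q))) ≡ length xs) (pairPicks xs)
pairPicks-length-rest []       = []
pairPicks-length-rest (x ∷ xs) =
  ++⁺ (map⁺ (All.map (cong suc) (picks-length-rest xs))) (map⁺ (All.map (cong suc) (pairPicks-length-rest xs)))

pairPicks-⊆ : (xs : List A) → All (λ q → proj₂ q ⊆ xs) (pairPicks xs)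
pairPicks-⊆ []       = []
pairPicks-⊆ (x ∷ xs) = ++⁺ (map⁺ (All.map (x ∷ʳ_) (picks-⊆ xs))) (map⁺ (All.map (refl ∷_) (pairPicks-⊆ xs)))

∑-picks-picks-swap : (l : List A) (g : A → A → List A → ℕ) →
  ∑ (λ p → ∑ (λ p′ → g (proj₁ p) (proj₁ p′) (proj₂ p′)) (picks (proj₂ p))) (picks l) ≡
  ∑ (λ p → ∑ (λ p′ → g (proj₁ p′) (proj₁ p) (proj₂ p′)) (picks (proj₂ p))) (picks l)
∑-picks-picks-swap []       g = refl
∑-picks-picks-swap {A} (v ∷ vs) g = begin-equality
  ∑ (λ p → ∑ (λ p′ → g (proj₁ p) (proj₁ p′) (proj₂ p′)) (picks (proj₂ p))) (picks (v ∷ vs))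
    ≡⟨ ∑-picks-∷ _ v vs ⟩
  X + ∑ (λ p → ∑ (λ p′ → g (proj₁ p) (proj₁ p′) (proj₂ p′)) (picks (v ∷ proj₂ p))) (picks vs)
    ≡⟨ cong (X +_) (∑-cong (λ p → cong (vLast p +_) (∑-map _ _ (picks (proj₂ p)))) (picks vs)) ⟩
  X + ∑ (λ p → vLast p + inner p) (picks vs)
    ≡⟨ cong (X +_) (∑-+ vLast inner (picks vs)) ⟩
  X + (∑ vLast (picks vs) + ∑ inner (picks vs))
    ≡⟨ cong (λ t → X + (∑ vLast (picks vs) + t)) (∑-picks-picks-swap vs (λ a b r → g a b (v ∷ r))) ⟩
  X + (∑ vLast (picks vs) + ∑ inner′ (picks vs))
    ≡⟨ +-leftComm X (∑ vLast (picks vs)) (∑ inner′ (picks vs)) ⟩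
  ∑ vLast (picks vs) + (X + ∑ inner′ (picks vs))
    ≡⟨ cong (∑ vLast (picks vs) +_) (sym (∑-+ vFirst inner′ (picks vs))) ⟩
  ∑ vLast (picks vs) + ∑ (λ p → vFirst p + inner′ p) (picks vs)
    ≡⟨ cong (∑ vLast (picks vs) +_) (∑-cong (λ p → cong (vFirst p +_) (sym (∑-map _ _ (picks (proj₂ p))))) (picks vs)) ⟩
  ∑ vLast (picks vs) + ∑ (λ p → ∑ (λ p′ → g (proj₁ p′) (proj₁ p) (proj₂ p′)) (picks (v ∷ proj₂ p))) (picks vs)
    ≡⟨ sym (∑-picks-∷ _ v vs) ⟩
  ∑ (λ p → ∑ (λ p′ → g (proj₁ p′) (proj₁ p) (proj₂ p′)) (picks (proj₂ p))) (picks (v ∷ vs)) ∎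
  where
  X : ℕ
  X = ∑ (λ p′ → g v (proj₁ p′) (proj₂ p′)) (picks vs)
  vLast vFirst inner inner′ : A × List A → ℕ
  vLast p = g (proj₁ p) v (proj₂ p)
  vFirst p = g v (proj₁ p) (proj₂ p)
  inner p = ∑ (λ p′ → g (proj₁ p) (proj₁ p′) (v ∷ proj₂ p′)) (picks (proj₂ p))
  inner′ p = ∑ (λ p′ → g (proj₁ p′) (proj₁ p) (v ∷ proj₂ p′)) (picks (proj₂ p))

∑-picks-pairPicks-interchange : (xs : List A) (f : A → A × A → List A → ℕ) →
  ∑ (λ p → ∑ (λ q → f (proj₁ p) (proj₁ q) (proj₂ q)) (pairPicks (proj₂ p))) (picks xs) ≡
  ∑ (λ q → ∑ (λ p → f (proj₁ p) (proj₁ q) (proj₂ p)) (picks (proj₂ q))) (pairPicks xs)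
∑-picks-pairPicks-interchange []       f = refl
∑-picks-pairPicks-interchange {A} (u ∷ us) f = begin-equality
  ∑ (λ p → ∑ (λ q → f (proj₁ p) (proj₁ q) (proj₂ q)) (pairPicks (proj₂ p))) (picks (u ∷ us))
    ≡⟨ ∑-picks-∷ _ u us ⟩
  X + ∑ (λ p → ∑ (λ q → f (proj₁ p) (proj₁ q) (proj₂ q)) (pairPicks (u ∷ proj₂ p))) (picks us)
    ≡⟨ cong (X +_) (∑-cong (λ p → ∑-pairPicks-∷ _ u (proj₂ p)) (picks us)) ⟩
  X + ∑ (λ p → P₂ p + P₃ p) (picks us)
    ≡⟨ cong (X +_) (∑-+ P₂ P₃ (picks us)) ⟩
  X + (∑ P₂ (picks us) + ∑ P₃ (picks us))
    ≡⟨ cong₂ (λ a b → X + (a + b)) (∑-picks-picks-swap us (λ a b r → f a (u , b) r))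
                                   (∑-picks-pairPicks-interchange us (λ y c r → f y c (u ∷ r))) ⟩
  X + (R₁ + ∑ R₃ (pairPicks us))
    ≡⟨ +-leftComm X R₁ (∑ R₃ (pairPicks us)) ⟩
  R₁ + (X + ∑ R₃ (pairPicks us))
    ≡⟨ cong (R₁ +_) (sym (∑-+ Xq R₃ (pairPicks us))) ⟩
  R₁ + ∑ (λ q → Xq q + R₃ q) (pairPicks us)
    ≡⟨ cong (R₁ +_) (∑-cong (λ q → sym (∑-picks-∷ _ u (proj₂ q))) (pairPicks us)) ⟩
  R₁ + ∑ (λ q → ∑ (λ p → f (proj₁ p) (proj₁ q) (proj₂ p)) (picks (u ∷ proj₂ q))) (pairPicks us)
    ≡⟨ sym (∑-pairPicks-∷ _ u us) ⟩
  ∑ (λ q → ∑ (λ p → f (proj₁ p) (proj₁ q) (proj₂ p)) (picks (proj₂ q))) (pairPicks (u ∷ us)) ∎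
  where
  X R₁ : ℕ
  X = ∑ (λ q → f u (proj₁ q) (proj₂ q)) (pairPicks us)
  R₁ = ∑ (λ p → ∑ (λ p′ → f (proj₁ p′) (u , proj₁ p) (proj₂ p′)) (picks (proj₂ p))) (picks us)
  P₂ P₃ : A × List A → ℕ
  P₂ p = ∑ (λ p′ → f (proj₁ p) (u , proj₁ p′) (proj₂ p′)) (picks (proj₂ p))
  P₃ p = ∑ (λ q → f (proj₁ p) (proj₁ q) (u ∷ proj₂ q)) (pairPicks (proj₂ p))
  Xq R₃ : (A × A) × List A → ℕ
  Xq q = f u (proj₁ q) (proj₂ q)
  R₃ q = ∑ (λ p → f (proj₁ p) (proj₁ q) (u ∷ proj₂ p)) (picks (proj₂ q))

Matching : Set
Matching = List (ℕ × ℕ)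

oddFactorial : ℕ → ℕ
oddFactorial zero    = 1
oddFactorial (suc m) = suc (m + m) * oddFactorial m

oddFactorial-pos : ∀ m → 1 ≤ oddFactorial m
oddFactorial-pos zero    = s≤s z≤n
oddFactorial-pos (suc m) = ≤-trans (oddFactorial-pos m) (m≤n*m (oddFactorial m) (suc (m + m)))

length-matchings : (m : ℕ) (l : List ℕ) → length l ≡ m + m → length (matchings m l) ≡ oddFactorial m
length-matchings zero    []       _ = refl
length-matchings (suc m) (x ∷ xs) e = begin-equality
  length (matchings (suc m) (x ∷ xs))            ≡⟨ length≡∑1 (matchings (suc m) (x ∷ xs)) ⟩
  ∑ (λ _ → 1) (concatMap branch (picks xs))      ≡⟨ ∑-concatMap _ branch (picks xs) ⟩
  ∑ (∑ (λ _ → 1) ∘ branch) (picks xs)            ≡⟨ ∑-constAll _ (picks xs) (All.map count (picks-length-rest xs)) ⟩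
  length (picks xs) * oddFactorial m             ≡⟨ cong (_* oddFactorial m) (trans (length-picks xs) ∣xs∣) ⟩
  suc (m + m) * oddFactorial m                   ∎
  where
  branch : ℕ × List ℕ → List Matching
  branch p = map ((x , proj₁ p) ∷_) (matchings m (proj₂ p))
  ∣xs∣ : length xs ≡ suc (m + m)
  ∣xs∣ = trans (suc-injective e) (+-suc m m)
  count : {p : ℕ × List ℕ} → suc (length (proj₂ p)) ≡ length xs → ∑ (λ _ → 1) (branch p) ≡ oddFactorial m
  count {p} e′ = begin-equality
    ∑ (λ _ → 1) (branch p)          ≡⟨ sym (length≡∑1 (branch p)) ⟩
    length (branch p)               ≡⟨ length-map _ (matchings m (proj₂ p)) ⟩
    length (matchings m (proj₂ p))  ≡⟨ length-matchings m (proj₂ p) (suc-injective (trans e′ ∣xs∣)) ⟩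
    oddFactorial m                  ∎

-- A matching with a marked chord is the same as a pair of points (the marked chord)
-- together with a matching of the remaining points.
∑-matchings-picks : (m : ℕ) (l : List ℕ) (h : ℕ × ℕ → Matching → ℕ) →
  ∑ (λ D → ∑ (λ p → h (proj₁ p) (proj₂ p)) (picks D)) (matchings (suc m) l) ≡
  ∑ (λ q → ∑ (h (proj₁ q)) (matchings m (proj₂ q))) (pairPicks l)

-- The case where the marked chord is not the chord at the first point x.
∑-matchings-picks-tail : (m x : ℕ) (xs : List ℕ) (h : ℕ × ℕ → Matching → ℕ) →
  ∑ (λ p → ∑ (λ E → ∑ (λ p′ → h (proj₁ p′) ((x , proj₁ p) ∷ proj₂ p′)) (picks E))
               (matchings m (proj₂ p))) (picks xs) ≡
  ∑ (λ q → ∑ (h (proj₁ q)) (matchings m (x ∷ proj₂ q))) (pairPicks xs)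

∑-matchings-picks m []       h = refl
∑-matchings-picks m (x ∷ xs) h = begin-equality
  ∑ H (concatMap branch (picks xs))
    ≡⟨ ∑-concatMap H branch (picks xs) ⟩
  ∑ (λ p → ∑ H (branch p)) (picks xs)
    ≡⟨ ∑-cong (λ p → trans (∑-map H _ (matchings m (proj₂ p)))
                   (trans (∑-cong (λ E → ∑-picks-∷ (λ p′ → h (proj₁ p′) (proj₂ p′)) _ E) (matchings m (proj₂ p)))
                          (∑-+ (h (x , proj₁ p)) (K p) (matchings m (proj₂ p))))) (picks xs) ⟩
  ∑ (λ p → A₁ p + A₂ p) (picks xs)
    ≡⟨ ∑-+ A₁ A₂ (picks xs) ⟩
  ∑ A₁ (picks xs) + ∑ A₂ (picks xs)
    ≡⟨ cong (∑ A₁ (picks xs) +_) (∑-matchings-picks-tail m x xs h) ⟩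
  ∑ A₁ (picks xs) + ∑ (λ q → ∑ (h (proj₁ q)) (matchings m (x ∷ proj₂ q))) (pairPicks xs)
    ≡⟨ sym (∑-pairPicks-∷ (λ q → ∑ (h (proj₁ q)) (matchings m (proj₂ q))) x xs) ⟩
  ∑ (λ q → ∑ (h (proj₁ q)) (matchings m (proj₂ q))) (pairPicks (x ∷ xs)) ∎
  where
  H : Matching → ℕ
  H D = ∑ (λ p → h (proj₁ p) (proj₂ p)) (picks D)
  branch : ℕ × List ℕ → List Matching
  branch p = map ((x , proj₁ p) ∷_) (matchings m (proj₂ p))
  K : ℕ × List ℕ → Matching → ℕ
  K p E = ∑ (λ p′ → h (proj₁ p′) ((x , proj₁ p) ∷ proj₂ p′)) (picks E)
  A₁ A₂ : ℕ × List ℕ → ℕ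
  A₁ p = ∑ (h (x , proj₁ p)) (matchings m (proj₂ p))
  A₂ p = ∑ (K p) (matchings m (proj₂ p))

∑-matchings-picks-tail zero x xs h =
  trans (∑-zero (λ p → no-chords _ (proj₂ p)) (picks xs)) (sym (∑-zero (λ q → refl) (pairPicks xs)))
  where
  no-chords : (g : (ℕ × ℕ) × Matching → ℕ) (r : List ℕ) → ∑ (λ E → ∑ g (picks E)) (matchings 0 r) ≡ 0
  no-chords g []      = refl
  no-chords g (_ ∷ _) = refl
∑-matchings-picks-tail (suc m) x xs h = begin-equality
  ∑ (λ p → ∑ (λ E → ∑ (λ p′ → h (proj₁ p′) ((x , proj₁ p) ∷ proj₂ p′)) (picks E))
               (matchings (suc m) (proj₂ p))) (picks xs)
    ≡⟨ ∑-cong (λ p → ∑-matchings-picks m (proj₂ p) (λ c E → h c ((x , proj₁ p) ∷ E))) (picks xs) ⟩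
  ∑ (λ p → ∑ (λ q → ∑ (λ E → h (proj₁ q) ((x , proj₁ p) ∷ E)) (matchings m (proj₂ q)))
               (pairPicks (proj₂ p))) (picks xs)
    ≡⟨ ∑-picks-pairPicks-interchange xs (λ y c r → ∑ (λ E → h c ((x , y) ∷ E)) (matchings m r)) ⟩
  ∑ (λ q → ∑ (λ p → ∑ (λ E → h (proj₁ q) ((x , proj₁ p) ∷ E)) (matchings m (proj₂ p)))
               (picks (proj₂ q))) (pairPicks xs)
    ≡⟨ ∑-cong (λ q → sym (trans (∑-concatMap (h (proj₁ q)) _ (picks (proj₂ q)))
                          (∑-cong (λ p → ∑-map (h (proj₁ q)) _ (matchings m (proj₂ p))) (picks (proj₂ q))))) (pairPicks xs) ⟩
  ∑ (λ q → ∑ (h (proj₁ q)) (matchings (suc m) (x ∷ proj₂ q))) (pairPicks xs) ∎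

module ChordWeight (w : ℕ × ℕ → ℕ) where

  weight : Matching → ℕ
  weight = ∑ w

  pairWeight : List ℕ → ℕ
  pairWeight l = ∑ (w ∘ proj₁) (pairPicks l)

  pairWeight-∷ : (x : ℕ) (xs : List ℕ) → pairWeight (x ∷ xs) ≡ ∑ (λ y → w (x , y)) xs + pairWeight xs
  pairWeight-∷ x xs = trans (∑-pairPicks-∷ (w ∘ proj₁) x xs) (cong (_+ pairWeight xs) (∑-picks-proj₁ (λ y → w (x , y)) xs))

  pairWeight-⊆ : {xs ys : List ℕ} → xs ⊆ ys → pairWeight xs ≤ pairWeight ys
  pairWeight-⊆ [] = z≤n
  pairWeight-⊆ (_∷ʳ_ {ys = ys} y s) =
    ≤-trans (pairWeight-⊆ s) (≤-trans (m≤n+m _ _) (≤-reflexive (sym (pairWeight-∷ y ys))))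
  pairWeight-⊆ (_∷_ {x} {xs} {_} {ys} refl s) =
    ≤-trans (≤-reflexive (pairWeight-∷ x xs))
      (≤-trans (+-mono-≤ (∑-⊆ (λ z → w (x , z)) s) (pairWeight-⊆ s)) (≤-reflexive (sym (pairWeight-∷ x ys))))

  weight²-picks : (D : Matching) → ∑ (λ p → w (proj₁ p) * (w (proj₁ p) + weight (proj₂ p))) (picks D) ≡ weight D * weight D
  weight²-picks []       = refl
  weight²-picks (a ∷ as) = begin-equality
    ∑ F (picks (a ∷ as))
      ≡⟨ ∑-picks-∷ F a as ⟩
    F (a , as) + ∑ (λ p → w (proj₁ p) * (w (proj₁ p) + (w a + weight (proj₂ p)))) (picks as)
      ≡⟨ cong (F (a , as) +_) (trans (∑-cong (λ p → split (w (proj₁ p)) (w a) (weight (proj₂ p))) (picks as))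
                                     (∑-+ F (λ p → w a * w (proj₁ p)) (picks as))) ⟩
    F (a , as) + (∑ F (picks as) + ∑ (λ p → w a * w (proj₁ p)) (picks as))
      ≡⟨ cong₂ (λ u v → F (a , as) + (u + v)) (weight²-picks as)
               (trans (∑-*ˡ (w a) (w ∘ proj₁) (picks as)) (cong (w a *_) (∑-picks-proj₁ w as))) ⟩
    w a * (w a + weight as) + (weight as * weight as + w a * weight as)
      ≡⟨ square (w a) (weight as) ⟩
    (w a + weight as) * (w a + weight as) ∎
    where
    F : (ℕ × ℕ) × Matching → ℕ
    F p = w (proj₁ p) * (w (proj₁ p) + weight (proj₂ p))
    split : ∀ c a s → c * (c + (a + s)) ≡ c * (c + s) + a * c
    split = solve-∀
    square : ∀ a s → a * (a + s) + (s * s + a * s) ≡ (a + s) * (a + s)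
    square = solve-∀

  private
    length-rest : (m : ℕ) (l r : List ℕ) → length l ≡ suc m + suc m → suc (suc (length r)) ≡ length l → length r ≡ m + m
    length-rest m l r e e′ = suc-injective (trans (suc-injective (trans e′ e)) (+-suc m m))

  ∑-weight : (m : ℕ) (l : List ℕ) → length l ≡ suc m + suc m →
    ∑ weight (matchings (suc m) l) ≡ oddFactorial m * pairWeight l
  ∑-weight m l e = begin-equality
    ∑ weight (matchings (suc m) l)
      ≡⟨ ∑-cong (λ D → sym (∑-picks-proj₁ w D)) (matchings (suc m) l) ⟩
    ∑ (λ D → ∑ (w ∘ proj₁) (picks D)) (matchings (suc m) l)
      ≡⟨ ∑-matchings-picks m l (λ c _ → w c) ⟩
    ∑ (λ q → ∑ (λ _ → w (proj₁ q)) (matchings m (proj₂ q))) (pairPicks l)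
      ≡⟨ ∑-congAll (pairPicks l)
           (All.map (λ {q} e′ → count q (length-rest m l (proj₂ q) e e′)) (pairPicks-length-rest l)) ⟩
    ∑ (λ q → oddFactorial m * w (proj₁ q)) (pairPicks l)
      ≡⟨ ∑-*ˡ (oddFactorial m) (w ∘ proj₁) (pairPicks l) ⟩
    oddFactorial m * pairWeight l ∎
    where
    count : (q : (ℕ × ℕ) × List ℕ) → length (proj₂ q) ≡ m + m →
      ∑ (λ _ → w (proj₁ q)) (matchings m (proj₂ q)) ≡ oddFactorial m * w (proj₁ q)
    count q e′ = trans (∑-const (w (proj₁ q)) (matchings m (proj₂ q)))
                       (cong (_* w (proj₁ q)) (length-matchings m (proj₂ q) e′))

  ∑-weight² : (m : ℕ) (l : List ℕ) → length l ≡ suc (suc m) + suc (suc m) →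
    ∑ (λ D → weight D * weight D) (matchings (suc (suc m)) l) ≡
    oddFactorial (suc m) * ∑ (λ q → w (proj₁ q) * w (proj₁ q)) (pairPicks l) +
    oddFactorial m * ∑ (λ q → w (proj₁ q) * pairWeight (proj₂ q)) (pairPicks l)
  ∑-weight² m l e = begin-equality
    ∑ (λ D → weight D * weight D) (matchings (suc (suc m)) l)
      ≡⟨ ∑-cong (λ D → sym (weight²-picks D)) (matchings (suc (suc m)) l) ⟩
    ∑ (λ D → ∑ (λ p → w (proj₁ p) * (w (proj₁ p) + weight (proj₂ p))) (picks D)) (matchings (suc (suc m)) l)
      ≡⟨ ∑-matchings-picks (suc m) l (λ c E → w c * (w c + weight E)) ⟩
    ∑ (λ q → ∑ (λ E → w (proj₁ q) * (w (proj₁ q) + weight E)) (matchings (suc m) (proj₂ q))) (pairPicks l)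
      ≡⟨ ∑-congAll (pairPicks l)
           (All.map (λ {q} e′ → moment q (length-rest (suc m) l (proj₂ q) e e′)) (pairPicks-length-rest l)) ⟩
    ∑ (λ q → oddFactorial (suc m) * (w (proj₁ q) * w (proj₁ q)) +
             oddFactorial m * (w (proj₁ q) * pairWeight (proj₂ q))) (pairPicks l)
      ≡⟨ ∑-+ _ _ (pairPicks l) ⟩
    ∑ (λ q → oddFactorial (suc m) * (w (proj₁ q) * w (proj₁ q))) (pairPicks l) +
    ∑ (λ q → oddFactorial m * (w (proj₁ q) * pairWeight (proj₂ q))) (pairPicks l)
      ≡⟨ cong₂ _+_ (∑-*ˡ (oddFactorial (suc m)) _ (pairPicks l)) (∑-*ˡ (oddFactorial m) _ (pairPicks l)) ⟩
    oddFactorial (suc m) * ∑ (λ q → w (proj₁ q) * w (proj₁ q)) (pairPicks l) +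
    oddFactorial m * ∑ (λ q → w (proj₁ q) * pairWeight (proj₂ q)) (pairPicks l) ∎
    where
    moment : (q : (ℕ × ℕ) × List ℕ) → length (proj₂ q) ≡ suc m + suc m →
      ∑ (λ E → w (proj₁ q) * (w (proj₁ q) + weight E)) (matchings (suc m) (proj₂ q)) ≡
      oddFactorial (suc m) * (w (proj₁ q) * w (proj₁ q)) + oddFactorial m * (w (proj₁ q) * pairWeight (proj₂ q))
    moment (c , r) e′ = begin-equality
      ∑ (λ E → w c * (w c + weight E)) M
        ≡⟨ ∑-cong (λ E → *-distribˡ-+ (w c) (w c) (weight E)) M ⟩
      ∑ (λ E → w c * w c + w c * weight E) M
        ≡⟨ ∑-+ _ _ M ⟩
      ∑ (λ _ → w c * w c) M + ∑ (λ E → w c * weight E) M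
        ≡⟨ cong₂ _+_ (∑-const (w c * w c) M) (trans (∑-*ˡ (w c) weight M) (cong (w c *_) (∑-weight m r e′))) ⟩
      length M * (w c * w c) + w c * (oddFactorial m * pairWeight r)
        ≡⟨ cong₂ _+_ (cong (_* (w c * w c)) (length-matchings (suc m) r e′)) (*-leftComm (w c) (oddFactorial m) (pairWeight r)) ⟩
      oddFactorial (suc m) * (w c * w c) + oddFactorial m * (w c * pairWeight r) ∎
      where
      M : List Matching
      M = matchings (suc m) r

  ∑-pairPicks-cross≤ : (l : List ℕ) →
    ∑ (λ q → w (proj₁ q) * pairWeight (proj₂ q)) (pairPicks l) ≤ pairWeight l * pairWeight l
  ∑-pairPicks-cross≤ l =
    ≤-trans (∑-monoAll (pairPicks l) (All.map (λ {q} s → *-monoʳ-≤ (w (proj₁ q)) (pairWeight-⊆ s)) (pairPicks-⊆ l)))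
            (≤-reflexive (∑-*ʳ (pairWeight l) (w ∘ proj₁) (pairPicks l)))

sumBelow : (ℕ → ℕ) → ℕ → ℕ
sumBelow f zero    = 0
sumBelow f (suc c) = sumBelow f c + f c

sumBelow-cong : {f g : ℕ → ℕ} → (∀ i → f i ≡ g i) → (c : ℕ) → sumBelow f c ≡ sumBelow g c
sumBelow-cong e zero    = refl
sumBelow-cong e (suc c) = cong₂ _+_ (sumBelow-cong e c) (e c)

sumBelow-suc : (f : ℕ → ℕ) (c : ℕ) → sumBelow f (suc c) ≡ f 0 + sumBelow (f ∘ suc) c
sumBelow-suc f zero    = +-comm 0 (f 0)
sumBelow-suc f (suc c) = trans (cong (_+ f (suc c)) (sumBelow-suc f c)) (+-assoc (f 0) _ _)

interval : ℕ → ℕ → List ℕ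
interval a zero    = []
interval a (suc c) = a ∷ interval (suc a) c

∑-interval : (f : ℕ → ℕ) (a c : ℕ) → ∑ f (interval a c) ≡ sumBelow (λ i → f (a + i)) c
∑-interval f a zero    = refl
∑-interval f a (suc c) = begin-equality
  f a + ∑ f (interval (suc a) c)                 ≡⟨ cong₂ _+_ (cong f (sym (+-identityʳ a))) (∑-interval f (suc a) c) ⟩
  f (a + 0) + sumBelow (λ i → f (suc a + i)) c   ≡⟨ cong (f (a + 0) +_) (sumBelow-cong (λ i → cong f (sym (+-suc a i))) c) ⟩
  f (a + 0) + sumBelow (λ i → f (a + suc i)) c   ≡⟨ sumBelow-suc (λ i → f (a + i)) c ⟨
  sumBelow (λ i → f (a + i)) (suc c)             ∎

applyUpTo≡interval : (f : ℕ → ℕ) (a c : ℕ) → (∀ j → f j ≡ a + j) → applyUpTo f c ≡ interval a c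
applyUpTo≡interval f a zero    e = refl
applyUpTo≡interval f a (suc c) e = cong₂ _∷_ (trans (e 0) (+-identityʳ a))
  (applyUpTo≡interval (f ∘ suc) (suc a) c (λ j → trans (e (suc j)) (+-suc a j)))

points≡interval : (n : ℕ) → points n ≡ interval 1 (2 * n)
points≡interval n = trans (map-applyUpTo (λ x → x) suc (2 * n)) (applyUpTo≡interval suc 1 (2 * n) (λ _ → refl))

length-points : (n : ℕ) → length (points n) ≡ n + n
length-points n = trans (length-map suc (upTo (2 * n))) (trans (length-upTo (2 * n)) (cong (n +_) (+-identityʳ n)))

module ShortChords (n k : ℕ) where

  short : ℕ × ℕ → ℕ
  short c = indicator (chordLength n c <? k)

  open ChordWeight short public

  Z≡weight : (D : Matching) → Z n k D ≡ weight D
  Z≡weight = length-filter≡∑indicator (λ c → chordLength n c <? k)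

  short² : (c : ℕ × ℕ) → short c * short c ≡ short c
  short² c = indicator² (chordLength n c <? k)

  shortGap : ℕ → ℕ
  shortGap d = indicator (((d ∸ 1) ⊓ ((2 * n ∸ d) ∸ 1)) <? k)

  short≡shortGap : (a d : ℕ) → short (a , a + d) ≡ shortGap d
  short≡shortGap a d = cong (λ x → indicator (x <? k)) (cong₂ _⊓_ (cong (_∸ 1) (m+n∸m≡n a d))
    (cong (_∸ 1) (trans (cong (_∸ (a + d)) (+-comm (2 * n) a)) ([m+n]∸[m+o]≡n∸o a (2 * n) d))))

  shortGap-≤k : (d : ℕ) → 1 ≤ d → d ≤ k → shortGap d ≡ 1
  shortGap-≤k (suc d) _ d<k = indicator-yes _ (m<n⇒m⊓o<n _ d<k)

  shortGap-middle : (d : ℕ) → k < d → d + k < 2 * n → shortGap d ≡ 0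
  shortGap-middle (suc d) k<d d+k<2n = indicator-no _ (λ x → <⇒≱ x (⊓-glb (s≤s⁻¹ k<d) k≤rest))
    where
    k≤rest : k ≤ (2 * n ∸ suc d) ∸ 1
    k≤rest = subst (k ≤_) (sym (∸-+-assoc (2 * n) (suc d) 1))
      (m+n≤o⇒m≤o∸n k (≤-trans (≤-reflexive (rearrange k d)) d+k<2n))
      where
      rearrange : ∀ k d → k + (suc d + 1) ≡ suc (suc d + k)
      rearrange = solve-∀

  shortGap-wrap : (d : ℕ) → d < 2 * n → 2 * n ≤ d + k → shortGap d ≡ 1
  shortGap-wrap d d<2n 2n≤d+k =
    indicator-yes _ (m<n⇒o⊓m<n _ (pred< (2 * n ∸ d) (m<n⇒0<n∸m d<2n) (m≤n+o⇒m∸n≤o (2 * n) d 2n≤d+k)))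
    where
    pred< : ∀ x → 0 < x → x ≤ k → x ∸ 1 < k
    pred< (suc x) _ x≤k = x≤k

  gapCount : ℕ → ℕ
  gapCount = sumBelow (shortGap ∘ suc)

  ∑-short-interval : (a c : ℕ) → ∑ (λ y → short (a , y)) (interval (suc a) c) ≡ gapCount c
  ∑-short-interval a c = trans (∑-interval (λ y → short (a , y)) (suc a) c)
    (sumBelow-cong (λ i → trans (cong (λ y → short (a , y)) (sym (+-suc a i))) (short≡shortGap a (suc i))) c)

  pairWeight-interval : (a c : ℕ) → pairWeight (interval a c) ≡ sumBelow gapCount c
  pairWeight-interval a zero    = refl
  pairWeight-interval a (suc c) = begin-equality
    pairWeight (a ∷ interval (suc a) c)                          ≡⟨ pairWeight-∷ a (interval (suc a) c) ⟩
    ∑ (λ y → short (a , y)) (interval (suc a) c) + pairWeight (interval (suc a) c)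
      ≡⟨ cong₂ _+_ (∑-short-interval a c) (pairWeight-interval (suc a) c) ⟩
    gapCount c + sumBelow gapCount c                             ≡⟨ +-comm (gapCount c) _ ⟩
    sumBelow gapCount (suc c)                                    ∎

  -- gapCount c counts the short gaps among 1, …, c: it grows by one per step while c ≤ k,
  -- stays k over the long gaps, and grows again once 2n − c ≤ k.
  module _ (t : ℕ) (n≡ : n ≡ suc (k + t)) where

    private
      Q : ℕ → ℕ
      Q = sumBelow gapCount

      2n≡ : 2 * n ≡ suc (suc (k + k + (t + t)))
      2n≡ = trans (cong (2 *_) n≡) (double k t)
        where
        double : ∀ k t → 2 * suc (k + t) ≡ suc (suc (k + k + (t + t)))
        double = solve-∀

      phase₁ : ∀ c → c ≤ k → (gapCount c ≡ c) × (2 * Q c + c ≡ c * c)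
      phase₁ zero    _   = refl , refl
      phase₁ (suc c) c<k with phase₁ c (<⇒≤ c<k)
      ... | count≡ , sum≡ = count≡′ , trans (cong (λ x → 2 * (Q c + x) + suc c) count≡)
                                  (trans (step (Q c) c) (trans (cong (_+ (2 * c + 1)) sum≡) (square c)))
        where
        count≡′ : gapCount (suc c) ≡ suc c
        count≡′ = trans (cong₂ _+_ count≡ (shortGap-≤k (suc c) (s≤s z≤n) c<k)) (+-comm c 1)
        step : ∀ q c → 2 * (q + c) + suc c ≡ (2 * q + c) + (2 * c + 1)
        step = solve-∀
        square : ∀ c → c * c + (2 * c + 1) ≡ suc c * suc c
        square = solve-∀

      phase₂ : ∀ i → i ≤ suc (t + t) → (gapCount (k + i) ≡ k) × (2 * Q (k + i) + k ≡ k * k + 2 * i * k)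
      phase₂ zero _ rewrite +-identityʳ k with phase₁ k ≤-refl
      ... | count≡ , sum≡ = count≡ , trans sum≡ (sym (+-identityʳ (k * k)))
      phase₂ (suc i) i<2t+1 rewrite +-suc k i with phase₂ i (<⇒≤ i<2t+1)
      ... | count≡ , sum≡ = count≡′ , trans (cong (λ x → 2 * (Q (k + i) + x) + k) count≡)
                                  (trans (step (Q (k + i)) k) (trans (cong (_+ (2 * k)) sum≡) (step′ k i)))
        where
        long : suc (k + i) + k < 2 * n
        long = subst (suc (k + i) + k <_) (sym 2n≡)
          (s≤s (s≤s (≤-trans (≤-reflexive (rearrange k i)) (+-monoʳ-≤ (k + k) (s≤s⁻¹ i<2t+1)))))
          where
          rearrange : ∀ k i → k + i + k ≡ k + k + i
          rearrange = solve-∀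
        count≡′ : gapCount (suc (k + i)) ≡ k
        count≡′ = trans (cong₂ _+_ count≡ (shortGap-middle (suc (k + i)) (s≤s (m≤m+n k i)) long)) (+-identityʳ k)
        step : ∀ q k → 2 * (q + k) + k ≡ (2 * q + k) + 2 * k
        step = solve-∀
        step′ : ∀ k i → k * k + 2 * i * k + 2 * k ≡ k * k + 2 * suc i * k
        step′ = solve-∀

      c₀ : ℕ
      c₀ = k + suc (t + t)

      phase₃ : ∀ j → j ≤ k →
        (gapCount (c₀ + j) ≡ k + j) × (2 * Q (c₀ + j) + k + j ≡ k * k + 2 * suc (t + t) * k + 2 * j * k + j * j)
      phase₃ zero _ rewrite +-identityʳ c₀ with phase₂ (suc (t + t)) ≤-refl
      ... | count≡ , sum≡ = trans count≡ (sym (+-identityʳ k)) , trans (+-identityʳ _) (trans sum≡ (pad _))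
        where
        pad : ∀ x → x ≡ x + 0 + 0
        pad = solve-∀
      phase₃ (suc j) j<k rewrite +-suc c₀ j with phase₃ j (<⇒≤ j<k)
      ... | count≡ , sum≡ = count≡′ , trans (cong (λ x → 2 * (Q (c₀ + j) + x) + k + suc j) count≡)
                                  (trans (step (Q (c₀ + j)) k j) (trans (cong (_+ (2 * k + 2 * j + 1)) sum≡) (step′ k t j)))
        where
        inside : suc (c₀ + j) < 2 * n
        inside = subst (suc (c₀ + j) <_) (sym 2n≡) (s≤s (s≤s (≤-trans (≤-reflexive (rearrange k t j))
          (≤-trans (+-monoʳ-≤ (k + (t + t)) j<k) (≤-reflexive (rearrange′ k t))))))
          where
          rearrange : ∀ k t j → k + suc (t + t) + j ≡ k + (t + t) + suc j
          rearrange = solve-∀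
          rearrange′ : ∀ k t → k + (t + t) + k ≡ k + k + (t + t)
          rearrange′ = solve-∀
        wraps : 2 * n ≤ suc (c₀ + j) + k
        wraps = subst (_≤ suc (c₀ + j) + k) (sym 2n≡)
          (≤-trans (≤-reflexive (rearrange k t)) (≤-trans (m≤m+n _ j) (≤-reflexive (rearrange′ k t j))))
          where
          rearrange : ∀ k t → suc (suc (k + k + (t + t))) ≡ suc (k + suc (t + t) + k)
          rearrange = solve-∀
          rearrange′ : ∀ k t j → suc (k + suc (t + t) + k) + j ≡ suc (k + suc (t + t) + j) + k
          rearrange′ = solve-∀
        count≡′ : gapCount (suc (c₀ + j)) ≡ k + suc j
        count≡′ = trans (cong₂ _+_ count≡ (shortGap-wrap (suc (c₀ + j)) inside wraps)) (trans (+-assoc k j 1) (cong (k +_) (+-comm j 1)))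
        step : ∀ q k j → 2 * (q + (k + j)) + k + suc j ≡ (2 * q + k + j) + (2 * k + 2 * j + 1)
        step = solve-∀
        step′ : ∀ k t j → k * k + 2 * suc (t + t) * k + 2 * j * k + j * j + (2 * k + 2 * j + 1)
                        ≡ k * k + 2 * suc (t + t) * k + 2 * suc j * k + suc j * suc j
        step′ = solve-∀

      Q-2n : Q (2 * n) ≡ 2 * n * k
      Q-2n = *-cancelˡ-≡ (Q (2 * n)) (2 * n * k) 2 (begin-equality
        2 * Q (2 * n)                          ≡⟨ cong (λ x → 2 * Q x) (trans 2n≡ (rearrange k t)) ⟩
        2 * (Q (c₀ + k) + gapCount (c₀ + k))   ≡⟨ cong (λ x → 2 * (Q (c₀ + k) + x)) (proj₁ (phase₃ k ≤-refl)) ⟩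
        2 * (Q (c₀ + k) + (k + k))             ≡⟨ step (Q (c₀ + k)) k ⟩
        (2 * Q (c₀ + k) + k + k) + (k + k)     ≡⟨ cong (_+ (k + k)) (proj₂ (phase₃ k ≤-refl)) ⟩
        k * k + 2 * suc (t + t) * k + 2 * k * k + k * k + (k + k)
                                               ≡⟨ step′ k t ⟩
        2 * (suc (suc (k + k + (t + t))) * k)  ≡⟨ cong (λ x → 2 * (x * k)) 2n≡ ⟨
        2 * (2 * n * k)                        ∎)
        where
        rearrange : ∀ k t → suc (suc (k + k + (t + t))) ≡ suc (k + suc (t + t) + k)
        rearrange = solve-∀
        step : ∀ q k → 2 * (q + (k + k)) ≡ (2 * q + k + k) + (k + k)
        step = solve-∀
        step′ : ∀ k t → k * k + 2 * suc (t + t) * k + 2 * k * k + k * k + (k + k) ≡ 2 * (suc (suc (k + k + (t + t))) * k)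
        step′ = solve-∀

    pairWeight-points : pairWeight (points n) ≡ 2 * n * k
    pairWeight-points = trans (cong pairWeight (points≡interval n)) (trans (pairWeight-interval 1 (2 * n)) Q-2n)

∣m⊖n∣²+2nm≡m²+n² : ∀ m n → ℤ.∣ m ⊖ n ∣ * ℤ.∣ m ⊖ n ∣ + 2 * n * m ≡ m * m + n * n
∣m⊖n∣²+2nm≡m²+n² m n with ≤-total m n
... | inj₁ m≤n = trans (cong (λ x → x * x + 2 * n * m) (ℤ.∣⊖∣-≤ m≤n))
  (subst (λ n′ → (n ∸ m) * (n ∸ m) + 2 * n′ * m ≡ m * m + n′ * n′) (m+[n∸m]≡n m≤n) (identity m (n ∸ m)))
  where
  identity : ∀ m d → d * d + 2 * (m + d) * m ≡ m * m + (m + d) * (m + d)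
  identity = solve-∀
... | inj₂ n≤m = trans (cong (λ x → ℤ.∣ x ∣ * ℤ.∣ x ∣ + 2 * n * m) (ℤ.⊖-≥ n≤m))
  (subst (λ m′ → (m ∸ n) * (m ∸ n) + 2 * n * m′ ≡ m′ * m′ + n * n) (m+[n∸m]≡n n≤m) (identity n (m ∸ n)))
  where
  identity : ∀ n d → d * d + 2 * n * (n + d) ≡ (n + d) * (n + d) + n * n
  identity = solve-∀

-- Writing ε = p/q with p ≥ 1: if ε < |s/k − 1| then k < p·|s − k| ≤ q·|s − k|.
ε<∣s/k-1∣⇒k<↧ε*∣s-k∣ : (s k′ : ℕ) (ε : ℚ) → 0ℚ ℚ.< ε →
  ε ℚ.< ℚ.∣ frac s (suc k′) - 1ℚ ∣ → suc k′ < ↧ₙ ε * ℤ.∣ s ⊖ suc k′ ∣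
ε<∣s/k-1∣⇒k<↧ε*∣s-k∣ s k′ (mkℚ (ℤ.+ zero) _ _)   (ℚ.*<* (ℤ.+<+ ())) _
ε<∣s/k-1∣⇒k<↧ε*∣s-k∣ s k′ (mkℚ -[1+ _ ] _ _)   (ℚ.*<* ()) _
ε<∣s/k-1∣⇒k<↧ε*∣s-k∣ s k′ (mkℚ (ℤ.+ suc p) q-1 _) _ ε<dev = begin-strict
  suc k′                       ≡⟨ cong suc (*-identityʳ k′) ⟨
  suc (k′ * 1)                 ≤⟨ m≤n*m (suc (k′ * 1)) (suc p) ⟩
  suc p * suc (k′ * 1)         <⟨ p*k<dist*q ⟩
  ℤ.∣ num ∣ * suc q-1          ≡⟨ cong (λ z → ℤ.∣ z ∣ * suc q-1) num≡ ⟩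
  ℤ.∣ s ⊖ suc k′ ∣ * suc q-1   ≡⟨ *-comm _ (suc q-1) ⟩
  suc q-1 * ℤ.∣ s ⊖ suc k′ ∣   ∎
  where
  x : ℚ
  x = frac s (suc k′) - 1ℚ
  unnormalised : toℚᵘ ℚ.∣ x ∣ ℚᵘ.≃ ℚᵘ.∣ ℚᵘ.mkℚᵘ (ℤ.+ s) k′ ℚᵘ.- ℚᵘ.1ℚᵘ ∣
  unnormalised = ℚᵘ.≃-trans (ℚ.toℚᵘ-homo-∣-∣ x)
    (ℚᵘ.∣-∣-cong (ℚᵘ.≃-trans (ℚ.toℚᵘ-homo-+ (frac s (suc k′)) (ℚ.- 1ℚ))
    (ℚᵘ.+-cong (ℚ.toℚᵘ-fromℚᵘ (ℚᵘ.mkℚᵘ (ℤ.+ s) k′)) ℚᵘ.≃-refl)))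
  num : ℤ.ℤ
  num = (ℤ.+ s ℤ.* ℤ.+ 1) ℤ.+ (-[1+ 0 ] ℤ.* ℤ.+ suc k′)
  cross : ℤ.+ suc p ℤ.* ℤ.+ suc (k′ * 1) ℤ.< ℤ.+ ℤ.∣ num ∣ ℤ.* ℤ.+ suc q-1
  cross with ℚᵘ.<-respʳ-≃ unnormalised (ℚ.toℚᵘ-mono-< ε<dev)
  ... | ℚᵘ.*<* z = z
  num≡ : num ≡ s ⊖ suc k′
  num≡ = cong₂ ℤ._+_ (ℤ.*-identityʳ (ℤ.+ s)) (cong -[1+_] (+-identityʳ k′))
  p*k<dist*q : suc p * suc (k′ * 1) < ℤ.∣ num ∣ * suc q-1
  p*k<dist*q with subst₂ ℤ._<_ (sym (ℤ.pos-* (suc p) (suc (k′ * 1)))) (sym (ℤ.pos-* ℤ.∣ num ∣ (suc q-1))) cross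
  ... | ℤ.+<+ z = z

b*↧δ<T⇒b/T<δ : (b T : ℕ) (δ : ℚ) → 0ℚ ℚ.< δ → b * ↧ₙ δ < T → frac b T ℚ.< δ
b*↧δ<T⇒b/T<δ b zero     δ                       _                   ()
b*↧δ<T⇒b/T<δ b (suc T′) (mkℚ (ℤ.+ zero) _ _)      (ℚ.*<* (ℤ.+<+ ())) _
b*↧δ<T⇒b/T<δ b (suc T′) (mkℚ -[1+ _ ] _ _)      (ℚ.*<* ()) _
b*↧δ<T⇒b/T<δ b (suc T′) (mkℚ (ℤ.+ suc p) r-1 _) _ b*r<T =
  ℚ.toℚᵘ-cancel-< (ℚᵘ.<-respˡ-≃ (ℚᵘ.≃-sym (ℚ.toℚᵘ-fromℚᵘ (ℚᵘ.mkℚᵘ (ℤ.+ b) T′))) (ℚᵘ.*<* cross))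
  where
  cross : ℤ.+ b ℤ.* ℤ.+ suc r-1 ℤ.< ℤ.+ suc p ℤ.* ℤ.+ suc T′
  cross = subst₂ ℤ._<_ (ℤ.pos-* b (suc r-1)) (ℤ.pos-* (suc p) (suc T′))
    (ℤ.+<+ (<-≤-trans b*r<T (m≤n*m (suc T′) (suc p))))

module SecondMoment (k₀ t : ℕ) where

  m n k : ℕ
  m = k₀ + t
  n = suc (suc m)
  k = suc k₀

  open ShortChords n k

  private
    M : List Matching
    M = ChordDiagrams n

    W : ℕ
    W = pairWeight (points n)

    ∣points∣ : length (points n) ≡ suc (suc m) + suc (suc m)
    ∣points∣ = length-points n

  deviation : Matching → ℕ
  deviation D = ℤ.∣ weight D ⊖ k ∣

  ∑-deviation²+2k∑weight : ∑ (λ D → deviation D * deviation D) M + 2 * k * ∑ weight M ≡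
    ∑ (λ D → weight D * weight D) M + length M * (k * k)
  ∑-deviation²+2k∑weight = begin-equality
    ∑ (λ D → deviation D * deviation D) M + 2 * k * ∑ weight M
      ≡⟨ cong (∑ (λ D → deviation D * deviation D) M +_) (∑-*ˡ (2 * k) weight M) ⟨
    ∑ (λ D → deviation D * deviation D) M + ∑ (λ D → 2 * k * weight D) M
      ≡⟨ ∑-+ (λ D → deviation D * deviation D) (λ D → 2 * k * weight D) M ⟨
    ∑ (λ D → deviation D * deviation D + 2 * k * weight D) M
      ≡⟨ ∑-cong (λ D → ∣m⊖n∣²+2nm≡m²+n² (weight D) k) M ⟩
    ∑ (λ D → weight D * weight D + k * k) M
      ≡⟨ ∑-+ (λ D → weight D * weight D) (λ _ → k * k) M ⟩
    ∑ (λ D → weight D * weight D) M + ∑ (λ _ → k * k) M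
      ≡⟨ cong (∑ (λ D → weight D * weight D) M +_) (∑-const (k * k) M) ⟩
    ∑ (λ D → weight D * weight D) M + length M * (k * k) ∎

  ∑-weight²≤ : ∑ (λ D → weight D * weight D) M ≤ oddFactorial (suc m) * W + oddFactorial m * (W * W)
  ∑-weight²≤ = begin
    ∑ (λ D → weight D * weight D) M
      ≡⟨ ∑-weight² m (points n) ∣points∣ ⟩
    oddFactorial (suc m) * ∑ (λ q → short (proj₁ q) * short (proj₁ q)) (pairPicks (points n)) + oddFactorial m * C
      ≡⟨ cong (λ v → oddFactorial (suc m) * v + oddFactorial m * C) (∑-cong (short² ∘ proj₁) (pairPicks (points n))) ⟩
    oddFactorial (suc m) * W + oddFactorial m * C
      ≤⟨ +-monoʳ-≤ (oddFactorial (suc m) * W) (*-monoʳ-≤ (oddFactorial m) (∑-pairPicks-cross≤ (points n))) ⟩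
    oddFactorial (suc m) * W + oddFactorial m * (W * W) ∎
    where
    C : ℕ
    C = ∑ (λ q → short (proj₁ q) * pairWeight (proj₂ q)) (pairPicks (points n))

  -- With W = 2nk and (2n−1)!! = (2m+3)(2m+1)(2m−1)!!, the bound is a polynomial identity
  -- in k₀, t and (2m−1)!! up to a nonnegative slack.
  ∑-deviation²≤ : ∑ (λ D → deviation D * deviation D) M ≤ 5 * oddFactorial n * k
  ∑-deviation²≤ = +-cancelˡ-≤ (2 * k * ∑ weight M) X (5 * oddFactorial n * k) (begin
    2 * k * ∑ weight M + X                                                 ≡⟨ +-comm _ X ⟩
    X + 2 * k * ∑ weight M                                                 ≡⟨ ∑-deviation²+2k∑weight ⟩
    ∑ (λ D → weight D * weight D) M + length M * (k * k)
      ≤⟨ +-mono-≤ ∑-weight²≤ (≤-reflexive (cong (_* (k * k)) (length-matchings n (points n) ∣points∣))) ⟩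
    oddFactorial (suc m) * W + oddFactorial m * (W * W) + oddFactorial n * (k * k)  ≤⟨ m≤m+n _ slack ⟩
    bound W                                                                ≡⟨ cong bound W≡ ⟩
    bound (2 * n * k)                                                      ≡⟨ polynomial k₀ t (oddFactorial m) ⟩
    2 * k * (oddFactorial (suc m) * (2 * n * k)) + 5 * oddFactorial n * k
      ≡⟨ cong (λ z → 2 * k * z + 5 * oddFactorial n * k) ∑weight≡ ⟨
    2 * k * ∑ weight M + 5 * oddFactorial n * k                            ∎)
    where
    X slack : ℕ
    X = ∑ (λ D → deviation D * deviation D) M
    slack = k * oddFactorial m * (12 * m * m + 15 * m + (4 * m + 11) * t)
    bound : ℕ → ℕ
    bound z = oddFactorial (suc m) * z + oddFactorial m * (z * z) + oddFactorial n * (k * k) + slack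
    W≡ : W ≡ 2 * n * k
    W≡ = pairWeight-points t refl
    ∑weight≡ : ∑ weight M ≡ oddFactorial (suc m) * (2 * n * k)
    ∑weight≡ = trans (∑-weight (suc m) (points n) ∣points∣) (cong (oddFactorial (suc m) *_) W≡)
    polynomial : ∀ k₀ t A →
      let m = k₀ + t ; k = suc k₀ ; W = 2 * (2 + m) * k
          A₁ = suc (m + m) * A ; A₂ = suc (suc m + suc m) * A₁
      in A₁ * W + A * (W * W) + A₂ * (k * k) + k * A * (12 * m * m + 15 * m + (4 * m + 11) * t)
         ≡ 2 * k * (A₁ * W) + 5 * A₂ * k
    polynomial = solve-∀

  module _ (ε δ : ℚ) (0<ε : 0ℚ ℚ.< ε) (0<δ : 0ℚ ℚ.< δ) where

    private
      q r : ℕ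
      q = ↧ₙ ε
      r = ↧ₙ δ

    deviates? : (D : Matching) → Dec (ε ℚ.< ℚ.∣ frac (Z n k D) k - 1ℚ ∣)
    deviates? D = ε ℚ.<? ℚ.∣ frac (Z n k D) k - 1ℚ ∣

    #deviating : ℕ
    #deviating = length (filter deviates? M)

    indicator-deviates*k²≤ : (D : Matching) →
      indicator (deviates? D) * (k * k) ≤ q * q * (deviation D * deviation D)
    indicator-deviates*k²≤ D = indicator*≤ (deviates? D) (k * k) (q * q * (deviation D * deviation D))
      (λ dev → ≤-trans (*-mono-≤ (<⇒≤ (k<q*deviation dev)) (<⇒≤ (k<q*deviation dev)))
                       (≤-reflexive (square q (deviation D))))
      where
      k<q*deviation : ε ℚ.< ℚ.∣ frac (Z n k D) k - 1ℚ ∣ → k < q * deviation D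
      k<q*deviation dev =
        subst (λ z → k < q * ℤ.∣ z ⊖ k ∣) (Z≡weight D) (ε<∣s/k-1∣⇒k<↧ε*∣s-k∣ (Z n k D) k₀ ε 0<ε dev)
      square : ∀ a b → (a * b) * (a * b) ≡ a * a * (b * b)
      square = solve-∀

    -- Chebyshev's inequality, cleared of denominators.
    #deviating*k≤ : #deviating * k ≤ 5 * (q * q) * oddFactorial n
    #deviating*k≤ = *-cancelʳ-≤ (#deviating * k) (5 * (q * q) * oddFactorial n) k (begin
      #deviating * k * k                             ≡⟨ *-assoc #deviating k k ⟩
      #deviating * (k * k)                           ≡⟨ cong (_* (k * k)) (length-filter≡∑indicator deviates? M) ⟩
      ∑ (λ D → indicator (deviates? D)) M * (k * k)  ≡⟨ ∑-*ʳ (k * k) (λ D → indicator (deviates? D)) M ⟨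
      ∑ (λ D → indicator (deviates? D) * (k * k)) M  ≤⟨ ∑-monoAll M (universal indicator-deviates*k²≤ M) ⟩
      ∑ (λ D → q * q * (deviation D * deviation D)) M ≡⟨ ∑-*ˡ (q * q) (λ D → deviation D * deviation D) M ⟩
      q * q * ∑ (λ D → deviation D * deviation D) M  ≤⟨ *-monoʳ-≤ (q * q) ∑-deviation²≤ ⟩
      q * q * (5 * oddFactorial n * k)                ≡⟨ rearrange q (oddFactorial n) k ⟩
      5 * (q * q) * oddFactorial n * k                ∎)
      where
      rearrange : ∀ q T k → q * q * (5 * T * k) ≡ 5 * (q * q) * T * k
      rearrange = solve-∀

    probDeviation<δ : 5 * (q * q) * r < k → probDeviation n k ε ℚ.< δ
    probDeviation<δ 5q²r<k = b*↧δ<T⇒b/T<δ #deviating (length M) δ 0<δ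
      (subst (#deviating * r <_) (sym (length-matchings n (points n) ∣points∣))
        (*-cancelʳ-< k (#deviating * r) (oddFactorial n) (begin-strict
          #deviating * r * k                     ≡⟨ *-comm-middle #deviating r k ⟩
          #deviating * k * r                     ≤⟨ *-monoˡ-≤ r #deviating*k≤ ⟩
          5 * (q * q) * oddFactorial n * r       ≡⟨ *-comm-middle (5 * (q * q)) (oddFactorial n) r ⟩
          5 * (q * q) * r * oddFactorial n       <⟨ *-monoˡ-< (oddFactorial n) {{>-nonZero (oddFactorial-pos n)}} 5q²r<k ⟩
          k * oddFactorial n                     ≡⟨ *-comm k (oddFactorial n) ⟩
          oddFactorial n * k                     ∎)))
      where
      *-comm-middle : ∀ a b c → a * b * c ≡ a * c * b
      *-comm-middle = solve-∀

probDeviation<δ : (n k : ℕ) (ε δ : ℚ) → 0ℚ ℚ.< ε → 0ℚ ℚ.< δ → k ≤ n ∸ 1 →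
  5 * (↧ₙ ε * ↧ₙ ε) * ↧ₙ δ < k → probDeviation n k ε ℚ.< δ
probDeviation<δ n             zero     ε δ _   _   _     ()
probDeviation<δ zero          (suc k₀) ε δ _   _   ()    _
probDeviation<δ (suc zero)    (suc k₀) ε δ _   _   ()    _
probDeviation<δ (suc (suc m)) (suc k₀) ε δ 0<ε 0<δ k≤n-1 large =
  subst (λ x → probDeviation (suc (suc x)) (suc k₀) ε ℚ.< δ) (m+[n∸m]≡n (s≤s⁻¹ k≤n-1))
    (SecondMoment.probDeviation<δ k₀ (m ∸ k₀) ε δ 0<ε 0<δ large)

mainTheorem6 : (k : ℕ → ℕ) → (∀ n → k n ≤ n ∸ 1) →
  (∀ M → ∃[ N ] (∀ n → N ≤ n → M ≤ k n)) →
  ∀ (ε δ : ℚ) → 0ℚ ℚ.< ε → 0ℚ ℚ.< δ →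
  ∃[ N ] (∀ n → N ≤ n → probDeviation n (k n) ε ℚ.< δ)
mainTheorem6 k k≤n-1 k→∞ ε δ 0<ε 0<δ with k→∞ (suc (5 * (↧ₙ ε * ↧ₙ ε) * ↧ₙ δ))
... | N , K≤k = N , λ n N≤n → probDeviation<δ n (k n) ε δ 0<ε 0<δ (k≤n-1 n) (K≤k n N≤n)
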